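{- Let $G=(V,E)$ be a directed planar multigraph (parallel and antiparallel arcs allowed) in which every arc $e$ has a real cost $c(e)$, lower bound $0$ and a finite capacity $u(e)\ge 0$. Let $v_o\in V$ be a vertex such that $T=G[V\setminus\{v_o\}]$ is a directed fat tree, and let $v_c$ be a vertex of $T$. For every connected component $C$ of $T-v_c$, let $G_C$ be the network obtained as follows: take the subgraph of $G$ induced by $C\cup\{v_o,v_c\}$; remove all arcs between $v_c$ and $v_o$ except one (if there are none, add one such arc, of arbitrary direction, keeping planarity); then contract that single arc, i.e. delete it and $v_c$ and make every arc previously incident to $v_c$ incident to $v_o$ instead. Arcs of $G_C$ keep the costs and capacities of the corresponding arcs of $G$; thus every arc of $G$ not joining $v_c$ and $v_o$ corresponds to an arc of exactly one $G_C$. For each component $C$, let $f_C$ be a flow on $G_C$ with $0\le f_C(e)\le u(e)$ for all arcs $e$ of $G_C$, such that the residual network of $G_C$ with respect to $f_C$ contains no negative-cost cycle. Define a flow $f$ on $G$ by $f(e)=f_C(e)$ for every arc $e$ of $G$ not joining $v_c$ and $v_o$, where $C$ is the unique component with $e$ in $G_C$; and, for every arc $e$ joining $v_c$ and $v_o$ (in either direction), $f(e)=u(e)$ if $c(e)<0$ and $f(e)=0$ otherwise. Then the residual network $G_f$ contains no negative-cost cycle.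
   Context: A directed fat tree is a directed multigraph such that, if every arc is replaced by an undirected edge and every set of parallel edges is merged into a single edge, the result is a tree. The residual network $H_g$ of a network $H$ (arc costs $c$, capacities $u$, lower bounds $0$) with respect to a flow $g$ satisfying $0\le g(e)\le u(e)$ has the same vertex set as $H$; for every arc $e$ with $g(e)<u(e)$ it contains $e$ with cost $c(e)$ and capacity $u(e)-g(e)$, and for every arc $e$ with $g(e)>0$ it contains the reverse arc $e^{ -1}$ with cost $-c(e)$ and capacity $g(e)$. A negative-cost cycle is a directed cycle whose total arc cost is negative. -}

module Defs where

open import Level using () renaming (suc to lsuc; zero to lzero)
open import Data.Nat using (ℕ; zero; suc)
import Data.Nat as ℕ
open import Data.Bool using (Bool; true; false; not; _∧_; _∨_; if_then_else_)
open import Data.Fin using (Fin; zero; suc; inject₁; fromℕ; _≟_)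
open import Data.Product using (Σ; ∃; _×_; _,_; proj₁; proj₂)
open import Data.Sum using (_⊎_; inj₁; inj₂)
open import Data.List using (List; []; _∷_; allFin; upTo; concatMap; length; filter)
open import Data.Bool.ListAction using (any)
open import Relation.Nullary using (¬_; does)
open import Relation.Binary.PropositionalEquality using (_≡_; _≢_; refl)

-- Totally ordered abelian groups (the real numbers ℝ are an instance).
-- Costs, capacities and flow values live in such a group.

record OAG : Set₁ where
  infixl 6 _+_
  infix 4 _≤_ _<_
  field
    Carrier     : Set
    _+_         : Carrier → Carrier → Carrier
    0#          : Carrier
    -_          : Carrier → Carrier
    _≤_         : Carrier → Carrier → Set
    +-assoc     : ∀ x y z → (x + y) + z ≡ x + (y + z)
    +-comm      : ∀ x y → x + y ≡ y + x
    +-identityˡ : ∀ x → 0# + x ≡ x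
    -‿inverseˡ  : ∀ x → (- x) + x ≡ 0#
    ≤-refl      : ∀ x → x ≤ x
    ≤-trans     : ∀ {x y z} → x ≤ y → y ≤ z → x ≤ z
    ≤-antisym   : ∀ {x y} → x ≤ y → y ≤ x → x ≡ y
    ≤-total     : ∀ x y → (x ≤ y) ⊎ (y ≤ x)
    +-monoˡ-≤   : ∀ z {x y} → x ≤ y → x + z ≤ y + z

  _<_ : Carrier → Carrier → Set
  x < y = (x ≤ y) × (x ≢ y)

module Networks (R : OAG) where
  open OAG R

  record Network : Set₁ where
    field
      Vtx  : Set
      Arc  : Set
      tail : Arc → Vtx
      head : Arc → Vtx
      cost : Arc → Carrier
      cap  : Arc → Carrier

  module _ (N : Network) where
    open Network N

    Feasible : (Arc → Carrier) → Set
    Feasible g = ∀ e → (0# ≤ g e) × (g e ≤ cap e)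

    data ResArc (g : Arc → Carrier) : Set where
      fwd : (e : Arc) → g e < cap e → ResArc g   -- e, capacity u(e)-g(e)
      bwd : (e : Arc) → 0# < g e → ResArc g      -- e⁻¹, capacity g(e)

    rtail : ∀ {g} → ResArc g → Vtx
    rtail (fwd e _) = tail e
    rtail (bwd e _) = head e

    rhead : ∀ {g} → ResArc g → Vtx
    rhead (fwd e _) = head e
    rhead (bwd e _) = tail e

    rcost : ∀ {g} → ResArc g → Carrier
    rcost (fwd e _) = cost e
    rcost (bwd e _) = - cost e

    sumFin : ∀ k → (Fin k → Carrier) → Carrier
    sumFin zero    a = 0#
    sumFin (suc k) a = a zero + sumFin k (λ i → a (suc i))

    record Cycle (g : Arc → Carrier) : Set where
      field
        len      : ℕ
        arcs     : Fin (suc len) → ResArc g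
        consec   : ∀ (i : Fin len) → rhead (arcs (inject₁ i)) ≡ rtail (arcs (suc i))
        closes   : rhead (arcs (fromℕ len)) ≡ rtail (arcs zero)
        distinct : ∀ i j → rtail (arcs i) ≡ rtail (arcs j) → i ≡ j

      cycleCost : Carrier
      cycleCost = sumFin (suc len) (λ i → rcost (arcs i))

    NoNegCycle : (Arc → Carrier) → Set
    NoNegCycle g = (C : Cycle g) → ¬ (Cycle.cycleCost C < 0#)

module Graphs {n m : ℕ} (tl hd : Fin m → Fin n) where

  Loopless : Set
  Loopless = ∀ e → tl e ≢ hd e

  data Path (P : Fin n → Set) : Fin n → Fin n → Set where
    here  : ∀ {x} → P x → Path P x x
    stepₗ : ∀ {y} e → P (tl e) → Path P (hd e) y → Path P (tl e) y
    stepᵣ : ∀ {y} e → P (hd e) → Path P (tl e) y → Path P (hd e) y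

  Joins : Fin m → Fin n → Fin n → Set
  Joins e x y = ((tl e ≡ x) × (hd e ≡ y)) ⊎ ((tl e ≡ y) × (hd e ≡ x))

  -- T = G[V ∖ {vo}] is a directed fat tree: the underlying simple graph
  -- (parallel edges merged) is connected and has no cycle.
  module FatTree (vo : Fin n) where
    InT : Fin n → Set
    InT x = x ≢ vo

    AdjT : Fin n → Fin n → Set
    AdjT x y = InT x × InT y × ∃ λ e → Joins e x y

    Connected : Set
    Connected = ∀ x y → InT x → InT y → Path InT x y

    SimpleCycle : Set
    SimpleCycle = Σ ℕ λ k → Σ (Fin (3 ℕ.+ k) → Fin n) λ v →
        (∀ i j → v i ≡ v j → i ≡ j)
      × (∀ (i : Fin (2 ℕ.+ k)) → AdjT (v (inject₁ i)) (v (suc i)))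
      × AdjT (v (fromℕ (2 ℕ.+ k))) (v zero)

    IsFatTree : Set
    IsFatTree = Connected × ¬ SimpleCycle

  -- Planarity via combinatorial embeddings (rotation systems) of genus 0.
  -- Darts: (e , true) starts at tl e, (e , false) starts at hd e.

  Dart : Set
  Dart = Fin m × Bool

  origin : Dart → Fin n
  origin (e , true)  = tl e
  origin (e , false) = hd e

  flip : Dart → Dart
  flip (e , b) = (e , not b)

  iter : ∀ {A : Set} → (A → A) → ℕ → A → A
  iter f zero    x = x
  iter f (suc k) x = f (iter f k x)

  eqB : Fin n → Fin n → Bool
  eqB x y = does (x ≟ y)

  eqDart : Dart → Dart → Bool
  eqDart (e , b) (e' , b') = does (e ≟ e') ∧ eqBool b b'
    where
      eqBool : Bool → Bool → Bool
      eqBool true  true  = true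
      eqBool false false = true
      eqBool _     _     = false

  darts : List Dart
  darts = concatMap (λ e → (e , true) ∷ (e , false) ∷ []) (allFin m)

  countClasses : ∀ {A : Set} → (A → A → Bool) → List A → ℕ
  countClasses {A} r xs = go xs []
    where
      go : List A → List A → ℕ
      go []       seen = 0
      go (x ∷ xs) seen = if any (λ s → r s x) seen
                           then go xs (x ∷ seen)
                           else suc (go xs (x ∷ seen))

  -- number of orbits of a permutation π of the darts (an orbit has at
  -- most 2m elements, so powers below 2m suffice)
  orbits : (Dart → Dart) → ℕ
  orbits π = countClasses (λ d d' → any (λ k → eqDart (iter π k d) d') (upTo (2 ℕ.* m))) darts

  nonIsolated : Fin n → Bool
  nonIsolated v = any (λ e → eqB (tl e) v ∨ eqB (hd e) v) (allFin m)

  reachB : ℕ → Fin n → Fin n → Bool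
  reachB zero    x y = eqB x y
  reachB (suc k) x y = reachB k x y ∨
    any (λ e → (reachB k x (tl e) ∧ eqB (hd e) y) ∨ (reachB k x (hd e) ∧ eqB (tl e) y)) (allFin m)

  nonIsolatedVertices : ℕ
  nonIsolatedVertices = length (filter (λ v → nonIsolated v ≟B true) (allFin n))
    where
      open import Data.Bool.Properties using () renaming (_≟_ to _≟B_)

  components : ℕ
  components = countClasses (reachB n) (filter (λ v → nonIsolated v ≟B true) (allFin n))
    where
      open import Data.Bool.Properties using () renaming (_≟_ to _≟B_)

  record RotationSystem : Set where
    field
      σ        : Dart → Dart
      σ⁻¹      : Dart → Dart
      σσ⁻¹     : ∀ d → σ (σ⁻¹ d) ≡ d
      σ⁻¹σ     : ∀ d → σ⁻¹ (σ d) ≡ d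
      σ-origin : ∀ d → origin (σ d) ≡ origin d
      σ-cyclic : ∀ d d' → origin d ≡ origin d' → ∃ λ k → iter σ k d ≡ d'

    faces : ℕ
    faces = orbits (λ d → σ (flip d))

  -- Euler's formula V - E + F = 2 for every component (genus 0):
  -- summed over the components with an arc, V' + F = E + 2·κ'
  Planar : Set
  Planar = ∃ λ (ρ : RotationSystem) →
    nonIsolatedVertices ℕ.+ RotationSystem.faces ρ ≡ m ℕ.+ 2 ℕ.* components

module Construction (R : OAG) {n m : ℕ} (tl hd : Fin m → Fin n)
                    (cost cap : Fin m → OAG.Carrier R) (vo vc : Fin n) where
  open OAG R
  open Networks R
  open Graphs tl hd

  Gnet : Network
  Gnet = record { Vtx = Fin n ; Arc = Fin m ; tail = tl ; head = hd
                ; cost = cost ; cap = cap }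

  JoinsCO : Fin m → Set
  JoinsCO e = Joins e vc vo

  -- x lies in the component of T - vc containing w
  InComp : Fin n → Fin n → Set
  InComp w x = Path (λ v → (v ≢ vo) × (v ≢ vc)) w x

  InS : Fin n → Fin n → Set
  InS w x = InComp w x ⊎ (x ≡ vo ⊎ x ≡ vc)

  ArcC : Fin n → Set
  ArcC w = Σ (Fin m) λ e → InS w (tl e) × InS w (hd e) × ¬ JoinsCO e

  contract : ∀ {w} x → InS w x → Fin n
  contract x (inj₁ _) = x
  contract x (inj₂ _) = vo

  GC : Fin n → Network
  GC w = record
    { Vtx  = Fin n
    ; Arc  = ArcC w
    ; tail = λ a → contract (tl (proj₁ a)) (proj₁ (proj₂ a))
    ; head = λ a → contract (hd (proj₁ a)) (proj₁ (proj₂ (proj₂ a)))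
    ; cost = λ a → cost (proj₁ a)
    ; cap  = λ a → cap (proj₁ a)
    }

module Submission where

-- Contract vc into vo.  A simple cycle of the residual
-- network G_f that avoids vo and vc stays inside one component C of
-- T - vc, and it is literally a cycle of the residual network of G_C.
-- A simple cycle through vo or vc is cut at its (at most two) visits
-- of {vo, vc} into "segments": simple walks from a special vertex to a
-- special vertex whose inner vertices avoid vo and vc.  A segment with
-- no inner vertex is a single residual arc joining vc and vo, which is
-- not negative by the choice of f on those arcs; a segment with inner
-- vertices lies in C ∪ {vo, vc} for one component C, and contracting
-- vc into vo turns it into a simple closed walk of (G_C)_{f_C}, which
-- is not negative by hypothesis.

open import Defs
open import Data.Nat using (ℕ; zero; suc)
open import Data.Fin using (Fin; zero; suc; inject₁; fromℕ; _≟_)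
open import Data.Product using (_×_; _,_; proj₁; proj₂)
open import Data.Sum using (_⊎_; inj₁; inj₂; swap)
open import Data.Empty using (⊥-elim)
open import Data.List using (List; []; _∷_; _++_; tabulate)
open import Data.List.Relation.Unary.Any using (here; there)
open import Data.List.Relation.Unary.All as All using (All; []; _∷_)
open import Data.List.Relation.Unary.All.Properties using (All¬⇒¬Any; ++⁻ˡ; tabulate⁻)
open import Data.List.Relation.Unary.Unique.Propositional using (Unique; []; _∷_)
open import Data.List.Relation.Unary.Unique.Propositional.Properties using (tabulate⁺; Unique[x∷xs]⇒x∉xs)
open import Data.List.Membership.Propositional using (_∈_; _∉_)
open import Data.List.Membership.Propositional.Properties using (∈-++⁺ˡ; ∈-++⁺ʳ)
open import Data.List.Relation.Binary.Permutation.Propositional using (_↭_; ↭-sym; ↭-trans; ↭-reflexive; ↭⇒↭ₛ)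
open import Data.List.Relation.Binary.Permutation.Propositional.Properties using (++-comm; ∈-resp-↭)
import Data.List.Relation.Binary.Permutation.Setoid.Properties as PermutationSetoid
open import Relation.Nullary using (¬_; yes; no)
open import Relation.Binary.PropositionalEquality

-- Facts about totally ordered abelian groups.  "Not negative" (¬ x < 0)
-- is the form in which the absence of negative cycles is stated.
module OrderedGroupFacts (R : OAG) where
  open OAG R

  NotNeg : Carrier → Set
  NotNeg x = ¬ (x < 0#)

  notNeg-0 : NotNeg 0#
  notNeg-0 (_ , 0≢0) = 0≢0 refl

  nonneg⇒notNeg : ∀ {x} → 0# ≤ x → NotNeg x
  nonneg⇒notNeg 0≤x (x≤0 , x≢0) = x≢0 (≤-antisym x≤0 0≤x)

  -- by totality, a value that is not negative is (doubly negated) ≥ 0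
  notNeg⇒¬¬nonneg : ∀ {x} → NotNeg x → ¬ ¬ (0# ≤ x)
  notNeg⇒¬¬nonneg {x} notNeg ¬0≤x with ≤-total 0# x
  ... | inj₁ 0≤x = ¬0≤x 0≤x
  ... | inj₂ x≤0 = notNeg (x≤0 , λ x≡0 → ¬0≤x (subst (0# ≤_) (sym x≡0) (≤-refl 0#)))

  +-nonneg : ∀ {x y} → 0# ≤ x → 0# ≤ y → 0# ≤ x + y
  +-nonneg {x} {y} 0≤x 0≤y =
    ≤-trans (subst (0# ≤_) (sym (+-identityˡ y)) 0≤y) (+-monoˡ-≤ y 0≤x)

  notNeg-+ : ∀ {x y} → NotNeg x → NotNeg y → NotNeg (x + y)
  notNeg-+ notNegX notNegY neg =
    notNeg⇒¬¬nonneg notNegX λ 0≤x → notNeg⇒¬¬nonneg notNegY λ 0≤y →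
      nonneg⇒notNeg (+-nonneg 0≤x 0≤y) neg

  neg-negative⇒notNeg : ∀ {x} → - x < 0# → NotNeg x
  neg-negative⇒notNeg {x} (-x≤0 , _) =
    nonneg⇒notNeg (subst₂ _≤_ (-‿inverseˡ x) (+-identityˡ x) (+-monoˡ-≤ x -x≤0))

module UniqueLists {A : Set} where

  record UniqueCut (xs : List A) (v : A) (ys : List A) : Set where
    field
      uniqueBefore : Unique xs
      uniqueAfter  : Unique ys
      notBefore    : v ∉ xs
      notAfter     : v ∉ ys

  unique-cut : ∀ xs {v ys} → Unique (xs ++ v ∷ ys) → UniqueCut xs v ys
  unique-cut []       (v∉ys ∷ uys) = record
    { uniqueBefore = [] ; uniqueAfter = uys ; notBefore = λ () ; notAfter = All¬⇒¬Any v∉ys }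
  unique-cut (x ∷ xs) {v} (x∉ ∷ u) = record
    { uniqueBefore = ++⁻ˡ xs x∉ ∷ uniqueBefore ; uniqueAfter = uniqueAfter
    ; notBefore = v∉x∷xs ; notAfter = notAfter }
    where
      open UniqueCut (unique-cut xs u)
      v∉x∷xs : v ∉ x ∷ xs
      v∉x∷xs (here v≡x)   = All.lookup x∉ (∈-++⁺ʳ xs (here refl)) (sym v≡x)
      v∉x∷xs (there v∈xs) = notBefore v∈xs

  head∉tail : ∀ {x y : A} {xs} → x ≡ y → Unique (y ∷ xs) → x ∉ xs
  head∉tail refl = Unique[x∷xs]⇒x∉xs

  unique-tabulate⇒injective : ∀ {k} {h : Fin k → A} → Unique (tabulate h)
    → ∀ i j → h i ≡ h j → i ≡ j
  unique-tabulate⇒injective {suc k} (h₀∉ ∷ u) zero    zero    _ = refl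
  unique-tabulate⇒injective {suc k} (h₀∉ ∷ u) zero    (suc j) e = ⊥-elim (tabulate⁻ h₀∉ j e)
  unique-tabulate⇒injective {suc k} (h₀∉ ∷ u) (suc i) zero    e = ⊥-elim (tabulate⁻ h₀∉ i (sym e))
  unique-tabulate⇒injective {suc k} (h₀∉ ∷ u) (suc i) (suc j) e =
    cong suc (unique-tabulate⇒injective u i j e)

-- A walk records, for each residual
-- arc, that it starts where the previous one ended; the list of tail
-- vertices of a closed walk is its vertex sequence, so a closed walk
-- is simple iff that list is duplicate-free.
module ResidualWalks (R : OAG) (N : Networks.Network R)
                     (g : Networks.Network.Arc N → OAG.Carrier R) where
  open OAG R
  open Networks R
  open Network N using (Vtx)
  open OrderedGroupFacts R
  open UniqueLists

  RArc : Set
  RArc = ResArc N g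

  rt rh : RArc → Vtx
  rt = rtail N
  rh = rhead N

  rc : RArc → Carrier
  rc = rcost N

  data Walk : Vtx → Vtx → Set where
    nil  : ∀ {x y} → x ≡ y → Walk x y
    cons : ∀ {x z y} (a : RArc) → x ≡ rt a → rh a ≡ z → Walk z y → Walk x y

  tails : ∀ {x y} → Walk x y → List Vtx
  tails (nil _)        = []
  tails (cons a _ _ W) = rt a ∷ tails W

  wcost : ∀ {x y} → Walk x y → Carrier
  wcost (nil _)        = 0#
  wcost (cons a _ _ W) = rc a + wcost W

  cycleWalk : ∀ k (as : Fin (suc k) → RArc)
    → (∀ (i : Fin k) → rh (as (inject₁ i)) ≡ rt (as (suc i)))
    → ∀ {y} → rh (as (fromℕ k)) ≡ y → Walk (rt (as zero)) y
  cycleWalk zero    as consec end = cons (as zero) refl end (nil refl)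
  cycleWalk (suc k) as consec end =
    cons (as zero) refl (consec zero) (cycleWalk k (λ i → as (suc i)) (λ i → consec (suc i)) end)

  tails-cycleWalk : ∀ k as consec {y} (end : rh (as (fromℕ k)) ≡ y)
    → tails (cycleWalk k as consec end) ≡ tabulate (λ i → rt (as i))
  tails-cycleWalk zero    as consec end = refl
  tails-cycleWalk (suc k) as consec end =
    cong (rt (as zero) ∷_) (tails-cycleWalk k (λ i → as (suc i)) (λ i → consec (suc i)) end)

  wcost-cycleWalk : ∀ k as consec {y} (end : rh (as (fromℕ k)) ≡ y)
    → wcost (cycleWalk k as consec end) ≡ sumFin N (suc k) (λ i → rc (as i))
  wcost-cycleWalk zero    as consec end = refl
  wcost-cycleWalk (suc k) as consec end =
    cong (rc (as zero) +_) (wcost-cycleWalk k (λ i → as (suc i)) (λ i → consec (suc i)) end)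

  walksNotNeg⇒noNegCycle
    : (∀ {x} (W : Walk x x) → Unique (tails W) → NotNeg (wcost W)) → NoNegCycle N g
  walksNotNeg⇒noNegCycle walksNotNeg C =
    subst NotNeg (wcost-cycleWalk len arcs consec closes)
      (walksNotNeg W (subst Unique (sym (tails-cycleWalk len arcs consec closes))
                            (tabulate⁺ (λ {i} {j} → distinct i j))))
    where
      open Cycle C
      W = cycleWalk len arcs consec closes

  size : ∀ {x y} → Walk x y → ℕ
  size (nil _)        = 0
  size (cons _ _ _ W) = suc (size W)

  arcsFrom : ∀ {z y} → RArc → (W : Walk z y) → Fin (suc (size W)) → RArc
  arcsFrom a W              zero    = a
  arcsFrom a (nil _)        (suc ())
  arcsFrom a (cons b _ _ W) (suc i) = arcsFrom b W i

  arcsFrom-consec : ∀ {z y} (a : RArc) → rh a ≡ z → (W : Walk z y)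
    → ∀ (i : Fin (size W)) → rh (arcsFrom a W (inject₁ i)) ≡ rt (arcsFrom a W (suc i))
  arcsFrom-consec a enters (cons b leaves enters′ W) zero    = trans enters leaves
  arcsFrom-consec a enters (cons b leaves enters′ W) (suc i) = arcsFrom-consec b enters′ W i

  arcsFrom-end : ∀ {z y} (a : RArc) → rh a ≡ z → (W : Walk z y)
    → rh (arcsFrom a W (fromℕ (size W))) ≡ y
  arcsFrom-end a enters (nil z≡y)                 = trans enters z≡y
  arcsFrom-end a enters (cons b leaves enters′ W) = arcsFrom-end b enters′ W

  tails-arcsFrom : ∀ {z y} (a : RArc) (W : Walk z y)
    → rt a ∷ tails W ≡ tabulate (λ i → rt (arcsFrom a W i))
  tails-arcsFrom a (nil _)        = refl
  tails-arcsFrom a (cons b _ _ W) = cong (rt a ∷_) (tails-arcsFrom b W)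

  wcost-arcsFrom : ∀ {z y} (a : RArc) (W : Walk z y)
    → rc a + wcost W ≡ sumFin N (suc (size W)) (λ i → rc (arcsFrom a W i))
  wcost-arcsFrom a (nil _)        = refl
  wcost-arcsFrom a (cons b _ _ W) = cong (rc a +_) (wcost-arcsFrom b W)

  noNegCycle⇒walksNotNeg : NoNegCycle N g → ∀ {x} (W : Walk x x) → Unique (tails W) → NotNeg (wcost W)
  noNegCycle⇒walksNotNeg noNeg (nil _)                  _ = notNeg-0
  noNegCycle⇒walksNotNeg noNeg (cons a leaves enters W) u neg =
    noNeg C (subst (_< 0#) (wcost-arcsFrom a W) neg)
    where
      C : Cycle N g
      C = record
        { len      = size W
        ; arcs     = arcsFrom a W
        ; consec   = arcsFrom-consec a enters W
        ; closes   = trans (arcsFrom-end a enters W) leaves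
        ; distinct = unique-tabulate⇒injective (subst Unique (tails-arcsFrom a W) u)
        }

  _⊕_ : ∀ {x y z} → Walk x y → Walk y z → Walk x z
  nil x≡y                ⊕ nil y≡z                = nil (trans x≡y y≡z)
  nil x≡y                ⊕ cons a leaves enters W = cons a (trans x≡y leaves) enters W
  cons a leaves enters W ⊕ W′                     = cons a leaves enters (W ⊕ W′)

  tails-⊕ : ∀ {x y z} (W : Walk x y) (W′ : Walk y z) → tails (W ⊕ W′) ≡ tails W ++ tails W′
  tails-⊕ (nil _)        (nil _)        = refl
  tails-⊕ (nil _)        (cons _ _ _ _) = refl
  tails-⊕ (cons a _ _ W) W′             = cong (rt a ∷_) (tails-⊕ W W′)

  wcost-⊕ : ∀ {x y z} (W : Walk x y) (W′ : Walk y z) → wcost (W ⊕ W′) ≡ wcost W + wcost W′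
  wcost-⊕ (nil _)        (nil _)        = sym (+-identityˡ 0#)
  wcost-⊕ (nil _)        (cons _ _ _ _) = sym (+-identityˡ _)
  wcost-⊕ (cons a _ _ W) W′             =
    trans (cong (rc a +_) (wcost-⊕ W W′)) (sym (+-assoc (rc a) (wcost W) (wcost W′)))

  record Cut {x y} (v : Vtx) (W : Walk x y) : Set where
    field
      mid     : Vtx
      before  : Walk x v
      arc     : RArc
      leaves  : v ≡ rt arc
      enters  : rh arc ≡ mid
      after   : Walk mid y
      tailsEq : tails W ≡ tails before ++ rt arc ∷ tails after
      wcostEq : wcost W ≡ wcost before + (rc arc + wcost after)

  cut : ∀ {x y} v (W : Walk x y) → v ∈ tails W → Cut v W
  cut v (cons a leaves enters W) (here v≡a) = record
    { before = nil (trans leaves (sym v≡a)) ; arc = a ; leaves = v≡a ; enters = enters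
    ; after = W ; tailsEq = refl ; wcostEq = sym (+-identityˡ _) }
  cut v (cons a leaves enters W) (there v∈W) = record
    { before  = cons a leaves enters before ; arc = arc ; leaves = Cut.leaves c
    ; enters  = Cut.enters c ; after = after
    ; tailsEq = cong (rt a ∷_) tailsEq
    ; wcostEq = trans (cong (rc a +_) wcostEq) (sym (+-assoc _ _ _)) }
    where
      c = cut v W v∈W
      open Cut c hiding (leaves; enters)

  record Rotation {x} (v : Vtx) (W : Walk x x) : Set where
    field
      walk    : Walk v v
      wcostEq : wcost walk ≡ wcost W
      tails↭  : tails walk ↭ tails W

    unique : Unique (tails W) → Unique (tails walk)
    unique = PermutationSetoid.Unique-resp-↭ (setoid Vtx) (↭⇒↭ₛ (↭-sym tails↭))

    members : ∀ {u} → u ∈ tails walk → u ∈ tails W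
    members = ∈-resp-↭ tails↭

  rotate : ∀ {x} v (W : Walk x x) → v ∈ tails W → Rotation v W
  rotate v W v∈W = record
    { walk    = cons arc leaves enters (after ⊕ before)
    ; wcostEq = begin
        rc arc + wcost (after ⊕ before)        ≡⟨ cong (rc arc +_) (wcost-⊕ after before) ⟩
        rc arc + (wcost after + wcost before)  ≡⟨ sym (+-assoc (rc arc) _ _) ⟩
        (rc arc + wcost after) + wcost before  ≡⟨ +-comm _ (wcost before) ⟩
        wcost before + (rc arc + wcost after)  ≡⟨ sym wcostEq ⟩
        wcost W                                ∎
    ; tails↭  = ↭-trans (↭-reflexive (cong (rt arc ∷_) (tails-⊕ after before)))
               (↭-trans (++-comm (rt arc ∷ tails after) (tails before))
                        (↭-reflexive (sym tailsEq)))
    }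
    where
      open Cut (cut v W v∈W)
      open ≡-Reasoning

module PathFacts {n m : ℕ} (tl hd : Fin m → Fin n) where
  open Graphs tl hd using (Path; here; stepₗ; stepᵣ; Joins)

  path-snoc : ∀ {P x y z} → Path P x y → (e : Fin m) → Joins e y z → P z → Path P x z
  path-snoc (here Px) e (inj₁ (refl , refl)) Pz = stepₗ e Px (here Pz)
  path-snoc (here Px) e (inj₂ (refl , refl)) Pz = stepᵣ e Px (here Pz)
  path-snoc (stepₗ e′ Pt p) e j Pz = stepₗ e′ Pt (path-snoc p e j Pz)
  path-snoc (stepᵣ e′ Ph p) e j Pz = stepᵣ e′ Ph (path-snoc p e j Pz)

  path-end : ∀ {P x y} → Path P x y → P y
  path-end (here Py)     = Py
  path-end (stepₗ _ _ p) = path-end p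
  path-end (stepᵣ _ _ p) = path-end p

-- The contraction argument, for G, vo, vc, the flows g (which restricts
-- to the flows f_C on the networks G_C) and f as in the theorem.
module Contraction (R : OAG) {n m : ℕ} (tl hd : Fin m → Fin n)
  (cost cap : Fin m → OAG.Carrier R) (loopless : Graphs.Loopless tl hd) (vo vc : Fin n)
  (g : Fin m → OAG.Carrier R)
  (noNegCycleC : ∀ w → w ≢ vo → w ≢ vc → Networks.NoNegCycle R
                   (Construction.GC R tl hd cost cap vo vc w) (λ a → g (proj₁ a)))
  (f : Fin m → OAG.Carrier R)
  (f≡g : ∀ e → ¬ Construction.JoinsCO R tl hd cost cap vo vc e → f e ≡ g e)
  (f-saturated : ∀ e → Construction.JoinsCO R tl hd cost cap vo vc e
                   → OAG._<_ R (cost e) (OAG.0# R) → f e ≡ cap e)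
  (f-empty : ∀ e → Construction.JoinsCO R tl hd cost cap vo vc e
               → ¬ OAG._<_ R (cost e) (OAG.0# R) → f e ≡ OAG.0# R)
  where
  open OAG R
  open Networks R
  open Graphs tl hd using (Path; here; Joins)
  open Construction R tl hd cost cap vo vc
  open OrderedGroupFacts R
  open UniqueLists
  open PathFacts tl hd
  open import Data.List.Membership.DecPropositional (_≟_ {n}) using (_∈?_)

  module GW = ResidualWalks R Gnet f
  module CW (w : Fin n) = ResidualWalks R (GC w) (λ a → g (proj₁ a))
  open GW using (RArc; rt; rh; rc)

  Special : Fin n → Set
  Special v = v ≡ vo ⊎ v ≡ vc

  Off : Fin n → Set
  Off v = (v ≢ vo) × (v ≢ vc)

  off⇒¬special : ∀ {v} → Off v → ¬ Special v
  off⇒¬special (v≢vo , _) (inj₁ v≡vo) = v≢vo v≡vo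
  off⇒¬special (_ , v≢vc) (inj₂ v≡vc) = v≢vc v≡vc

  classify : ∀ v → Special v ⊎ Off v
  classify v with v ≟ vo | v ≟ vc
  ... | yes v≡vo | _        = inj₁ (inj₁ v≡vo)
  ... | no  _    | yes v≡vc = inj₁ (inj₂ v≡vc)
  ... | no  v≢vo | no  v≢vc = inj₂ (v≢vo , v≢vc)

  avoiding⇒off : ∀ {xs} → vo ∉ xs → vc ∉ xs → All Off xs
  avoiding⇒off vo∉ vc∉ =
    All.tabulate λ v∈ → (λ v≡vo → vo∉ (subst (_∈ _) v≡vo v∈)) , (λ v≡vc → vc∉ (subst (_∈ _) v≡vc v∈))

  image : Fin n → Fin n
  image v with classify v
  ... | inj₁ _ = vo
  ... | inj₂ _ = v

  image-special : ∀ {v} → Special v → image v ≡ vo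
  image-special {v} sp with classify v
  ... | inj₁ _   = refl
  ... | inj₂ off = ⊥-elim (off⇒¬special off sp)

  image-off : ∀ {v} → Off v → image v ≡ v
  image-off {v} off with classify v
  ... | inj₁ sp = ⊥-elim (off⇒¬special off sp)
  ... | inj₂ _  = refl

  contract-image : ∀ {w x} (s : InS w x) → contract x s ≡ image x
  contract-image (inj₁ path) = sym (image-off (path-end path))
  contract-image (inj₂ sp)   = sym (image-special sp)

  arcOf : RArc → Fin m
  arcOf (fwd e _) = e
  arcOf (bwd e _) = e

  residual-joins : (r : RArc) → Joins (arcOf r) (rt r) (rh r)
  residual-joins (fwd e _) = inj₁ (refl , refl)
  residual-joins (bwd e _) = inj₂ (refl , refl)

  joins-distinct : ∀ {e x y} → Joins e x y → x ≢ y
  joins-distinct {e} (inj₁ (refl , refl)) = loopless e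
  joins-distinct {e} (inj₂ (refl , refl)) = λ hd≡tl → loopless e (sym hd≡tl)

  joinsCO⇒special : ∀ {e x y} → Joins e x y → JoinsCO e → Special x × Special y
  joinsCO⇒special (inj₁ (refl , refl)) (inj₁ (tl≡vc , hd≡vo)) = inj₂ tl≡vc , inj₁ hd≡vo
  joinsCO⇒special (inj₁ (refl , refl)) (inj₂ (tl≡vo , hd≡vc)) = inj₁ tl≡vo , inj₂ hd≡vc
  joinsCO⇒special (inj₂ (refl , refl)) (inj₁ (tl≡vc , hd≡vo)) = inj₁ hd≡vo , inj₂ tl≡vc
  joinsCO⇒special (inj₂ (refl , refl)) (inj₂ (tl≡vo , hd≡vc)) = inj₂ hd≡vc , inj₁ tl≡vo

  offEnd⇒¬joinsCO : (r : RArc) → Off (rt r) ⊎ Off (rh r) → ¬ JoinsCO (arcOf r)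
  offEnd⇒¬joinsCO r (inj₁ off) j = off⇒¬special off (proj₁ (joinsCO⇒special (residual-joins r) j))
  offEnd⇒¬joinsCO r (inj₂ off) j = off⇒¬special off (proj₂ (joinsCO⇒special (residual-joins r) j))

  special⇒joinsCO : ∀ {e x y} → Joins e x y → Special x → Special y → JoinsCO e
  special⇒joinsCO j (inj₁ refl) (inj₁ refl) = ⊥-elim (joins-distinct j refl)
  special⇒joinsCO j (inj₁ refl) (inj₂ refl) = swap j
  special⇒joinsCO j (inj₂ refl) (inj₁ refl) = j
  special⇒joinsCO j (inj₂ refl) (inj₂ refl) = ⊥-elim (joins-distinct j refl)

  -- the choice of f makes every residual arc joining vc and vo nonnegative:
  -- a negative arc is saturated, a nonnegative one is empty
  joinsCO⇒notNeg : (r : RArc) → JoinsCO (arcOf r) → NotNeg (rc r)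
  joinsCO⇒notNeg (fwd e (_ , f≢cap)) j neg = f≢cap (f-saturated e j neg)
  joinsCO⇒notNeg (bwd e (_ , 0≢f))   j neg = 0≢f (sym (f-empty e j (neg-negative⇒notNeg neg)))

  record LiftedArc (w : Fin n) (r : RArc) : Set where
    field
      arc     : CW.RArc w
      tailEq  : CW.rt w arc ≡ image (rt r)
      headEq  : CW.rh w arc ≡ image (rh r)
      costEq  : CW.rc w arc ≡ rc r

  -- an arc of G between vertices of C ∪ {vo, vc} not joining vc and vo
  -- is an arc of G_C; f and f_C agree on it, so residual arcs correspond
  liftArc : ∀ {w} (r : RArc) → InS w (rt r) → InS w (rh r) → ¬ JoinsCO (arcOf r) → LiftedArc w r
  liftArc (fwd e f<cap) st sh nj = record
    { arc = fwd (e , st , sh , nj) (subst (_< cap e) (f≡g e nj) f<cap)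
    ; tailEq = contract-image st ; headEq = contract-image sh ; costEq = refl }
  liftArc (bwd e 0<f) st sh nj = record
    { arc = bwd (e , sh , st , nj) (subst (0# <_) (f≡g e nj) 0<f)
    ; tailEq = contract-image st ; headEq = contract-image sh ; costEq = refl }

  -- x lies in C ∪ {vo, vc}, where C is the component containing w
  Within : Fin n → Fin n → Set
  Within w x = Off x → InComp w x

  within⇒InS : ∀ {w x} → Within w x → InS w x
  within⇒InS {x = x} within with classify x
  ... | inj₁ sp  = inj₂ sp
  ... | inj₂ off = inj₁ (within off)

  record LiftedWalk (w : Fin n) {x y} (W : GW.Walk x y) : Set where
    field
      walk    : CW.Walk w (image x) (image y)
      wcostEq : CW.wcost w walk ≡ GW.wcost W
      tailsEq : CW.tails w walk ≡ GW.tails W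

  -- a walk that starts in C ∪ {vo, vc} and leaves only from vertices of
  -- T - vc stays in C ∪ {vo, vc}, so it lifts to G_C
  liftWalk : ∀ {w x y} (W : GW.Walk x y) → Within w x → All Off (GW.tails W) → LiftedWalk w W
  liftWalk (GW.nil x≡y) _ [] =
    record { walk = CW.nil (cong image x≡y) ; wcostEq = refl ; tailsEq = refl }
  liftWalk {w} (GW.cons a leaves enters W) within (offTail ∷ offs) = record
    { walk    = CW.cons arc (trans (cong image leaves) (sym tailEq))
                              (trans headEq (cong image enters)) (LiftedWalk.walk rest)
    ; wcostEq = cong₂ _+_ costEq (LiftedWalk.wcostEq rest)
    ; tailsEq = cong₂ _∷_ (trans tailEq (image-off offTail)) (LiftedWalk.tailsEq rest)
    }
    where
      tailIn : InComp w (rt a)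
      tailIn = subst (InComp w) leaves (within (subst Off (sym leaves) offTail))
      headWithin : Within w (rh a)
      headWithin offHead = path-snoc tailIn (arcOf a) (residual-joins a) offHead
      open LiftedArc (liftArc a (inj₁ tailIn) (within⇒InS headWithin) (offEnd⇒¬joinsCO a (inj₁ offTail)))
      rest = liftWalk W (subst (Within w) enters headWithin) offs

  segmentNotNeg : ∀ {x z y} (a : RArc) → x ≡ rt a → rh a ≡ z → (W : GW.Walk z y)
    → Special x → Special y → All Off (GW.tails W) → Unique (GW.tails W)
    → NotNeg (rc a + GW.wcost W)
  segmentNotNeg a leaves enters (GW.nil z≡y) spX spY _ _ =
    notNeg-+ (joinsCO⇒notNeg a (special⇒joinsCO (residual-joins a)
                                  (subst Special leaves spX)
                                  (subst Special (sym (trans enters z≡y)) spY)))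
             notNeg-0
  segmentNotNeg {y = y} a leaves enters W@(GW.cons _ leaves′ _ _) spX spY offs@(offB ∷ _) uW =
    subst NotNeg wcostEq (CW.noNegCycle⇒walksNotNeg w noNeg closed uClosed)
    where
      -- the component of T - vc containing the inner vertices is that of w
      w = rh a
      offW : Off w
      offW = subst Off (sym (trans enters leaves′)) offB
      noNeg = noNegCycleC w (proj₁ offW) (proj₂ offW)
      open LiftedArc (liftArc a (inj₂ (subst Special leaves spX)) (inj₁ (here offW))
                              (offEnd⇒¬joinsCO a (inj₂ offW)))
      rest = liftWalk W (λ _ → subst (InComp w) enters (here offW)) offs
      tailIsVo : CW.rt w arc ≡ vo
      tailIsVo = trans tailEq (image-special (subst Special leaves spX))
      -- contracting vc into vo closes the segment up at vo
      closed : CW.Walk w (image y) (image y)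
      closed = CW.cons arc (trans (image-special spY) (sym tailIsVo))
                           (trans headEq (cong image enters)) (LiftedWalk.walk rest)
      uClosed : Unique (CW.tails w closed)
      uClosed = subst Unique (sym (cong₂ _∷_ tailIsVo (LiftedWalk.tailsEq rest)))
                  (All.map (λ off vo≡v → proj₁ off (sym vo≡v)) offs ∷ uW)
      wcostEq : CW.wcost w closed ≡ rc a + GW.wcost W
      wcostEq = cong₂ _+_ costEq (LiftedWalk.wcostEq rest)

  -- a simple closed walk avoiding vo and vc lies in one component of T - vc
  avoidingNotNeg : ∀ {s} (W : GW.Walk s s) → All Off (GW.tails W) → Unique (GW.tails W)
    → NotNeg (GW.wcost W)
  avoidingNotNeg (GW.nil _) _ _ = notNeg-0
  avoidingNotNeg {s} W@(GW.cons _ leaves _ _) offs@(offA ∷ _) uW =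
    subst NotNeg wcostEq
      (CW.noNegCycle⇒walksNotNeg s (noNegCycleC s (proj₁ offS) (proj₂ offS)) walk
                           (subst Unique (sym tailsEq) uW))
    where
      offS : Off s
      offS = subst Off (sym leaves) offA
      open LiftedWalk (liftWalk {s} W here offs)

  -- a simple closed walk at vc avoiding vo is a single segment
  atVcNotNeg : (W : GW.Walk vc vc) → vo ∉ GW.tails W → Unique (GW.tails W) → NotNeg (GW.wcost W)
  atVcNotNeg (GW.nil _) _ _ = notNeg-0
  atVcNotNeg (GW.cons a leaves enters W) vo∉ uaW@(_ ∷ uW) =
    segmentNotNeg a leaves enters W (inj₂ refl) (inj₂ refl)
      (avoiding⇒off (λ vo∈W → vo∉ (there vo∈W)) (head∉tail leaves uaW)) uW

  -- a simple closed walk at vo is one segment, or two if it passes vc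
  atVoNotNeg : (W : GW.Walk vo vo) → Unique (GW.tails W) → NotNeg (GW.wcost W)
  atVoNotNeg (GW.nil _) _ = notNeg-0
  atVoNotNeg (GW.cons a leaves enters W) uaW@(_ ∷ uW) with vc ∈? GW.tails W
  ... | no vc∉W =
    segmentNotNeg a leaves enters W (inj₁ refl) (inj₁ refl)
      (avoiding⇒off (head∉tail leaves uaW) vc∉W) uW
  ... | yes vc∈W = subst NotNeg (sym wcostEq′) (notNeg-+ toVc fromVc)
    where
      open GW.Cut (GW.cut vc W vc∈W) renaming (leaves to vc≡rt; enters to arcEnters)
      open UniqueCut (unique-cut (GW.tails before) (subst Unique tailsEq uW))
      vo∉cut : vo ∉ GW.tails before ++ rt arc ∷ GW.tails after
      vo∉cut vo∈ = head∉tail leaves uaW (subst (vo ∈_) (sym tailsEq) vo∈)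
      toVc : NotNeg (rc a + GW.wcost before)
      toVc = segmentNotNeg a leaves enters before (inj₁ refl) (inj₂ refl)
        (avoiding⇒off (λ vo∈ → vo∉cut (∈-++⁺ˡ vo∈))
                      (λ vc∈ → notBefore (subst (_∈ GW.tails before) vc≡rt vc∈)))
        uniqueBefore
      fromVc : NotNeg (rc arc + GW.wcost after)
      fromVc = segmentNotNeg arc vc≡rt arcEnters after (inj₂ refl) (inj₁ refl)
        (avoiding⇒off (λ vo∈ → vo∉cut (∈-++⁺ʳ (GW.tails before) (there vo∈)))
                      (λ vc∈ → notAfter (subst (_∈ GW.tails after) vc≡rt vc∈)))
        uniqueAfter
      wcostEq′ : rc a + GW.wcost W ≡ (rc a + GW.wcost before) + (rc arc + GW.wcost after)
      wcostEq′ = trans (cong (rc a +_) wcostEq) (sym (+-assoc _ _ _))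

  -- every simple closed walk of G_f is not negative: rotate it to start
  -- at vo, or else at vc, if it passes there
  closedWalkNotNeg : ∀ {s} (W : GW.Walk s s) → Unique (GW.tails W) → NotNeg (GW.wcost W)
  closedWalkNotNeg W uW with vo ∈? GW.tails W
  ... | yes vo∈W = subst NotNeg wcostEq (atVoNotNeg walk (unique uW))
    where open GW.Rotation (GW.rotate vo W vo∈W)
  ... | no vo∉W with vc ∈? GW.tails W
  ...   | yes vc∈W = subst NotNeg wcostEq (atVcNotNeg walk (λ vo∈ → vo∉W (members vo∈)) (unique uW))
    where open GW.Rotation (GW.rotate vc W vc∈W)
  ...   | no vc∉W = avoidingNotNeg W (avoiding⇒off vo∉W vc∉W) uW

  noNegCycle : NoNegCycle Gnet f
  noNegCycle = GW.walksNotNeg⇒noNegCycle closedWalkNotNeg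

mainTheorem1 : (R : OAG) → (n m : ℕ) → (tl hd : Fin m → Fin n)
  → (cost cap : Fin m → OAG.Carrier R)
  → Graphs.Loopless tl hd
  → Graphs.Planar tl hd
  → (∀ e → OAG._≤_ R (OAG.0# R) (cap e))
  → (vo vc : Fin n) → vc ≢ vo
  → Graphs.FatTree.IsFatTree tl hd vo
  → (g : Fin m → OAG.Carrier R)
  → (∀ w → w ≢ vo → w ≢ vc
       → Networks.Feasible R (Construction.GC R tl hd cost cap vo vc w) (λ a → g (proj₁ a))
       × Networks.NoNegCycle R (Construction.GC R tl hd cost cap vo vc w) (λ a → g (proj₁ a)))
  → (f : Fin m → OAG.Carrier R)
  → (∀ e → ¬ Construction.JoinsCO R tl hd cost cap vo vc e → f e ≡ g e)
  → (∀ e → Construction.JoinsCO R tl hd cost cap vo vc e → OAG._<_ R (cost e) (OAG.0# R) → f e ≡ cap e)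
  → (∀ e → Construction.JoinsCO R tl hd cost cap vo vc e → ¬ OAG._<_ R (cost e) (OAG.0# R) → f e ≡ OAG.0# R)
  → Networks.NoNegCycle R (Construction.Gnet R tl hd cost cap vo vc) f
mainTheorem1 R n m tl hd cost cap loopless _ _ vo vc _ _ g feasibleOptimalC f f≡g f-saturated f-empty =
  Contraction.noNegCycle R tl hd cost cap loopless vo vc g
    (λ w w≢vo w≢vc → proj₂ (feasibleOptimalC w w≢vo w≢vc)) f f≡g f-saturated f-empty
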